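{- For all positive integers $r,n$, \[\sum_{g\in G_{r,n}} q^{\text{flag-major}_F(g)}\,t^{ldes_F(\bar g)}=\sum_{g\in G_{r,n}} q^{finv_F(g)}\,t^{ldes_F(\bar g)},\] where for $g=(z,\pi)$ we set $\bar g=(z,\pi^{ -1})$.
   Context: $G_{r,n}$ is the set of pairs $g=(z,\pi)$ with $z\in\{0,\dots,r-1\}^n$, $\pi\in S_n$ (the wreath product $C_r\wr S_n$); $csum(g)=\sum_i z_i$. The friends order $F$ on letters $i^{[c]}$ ($i^{[0]}=i$) is $1<1^{[1]}<\dots<1^{[r-1]}<2<\dots<2^{[r-1]}<\dots<n<\dots<n^{[r-1]}$. $Des_F(g)=\{1\le i\le n-1:\pi(i)^{[z_i]}>_F\pi(i+1)^{[z_{i+1}]}\}$, $des_F(g)=|Des_F(g)|$, $maj_F(g)=\sum_{i\in Des_F(g)}i$, $inv_F(g)=|\{i<j:\pi(i)^{[z_i]}>_F\pi(j)^{[z_j]}\}|$, $\text{flag-major}_F(g)=r\,maj_F(g)+csum(g)$, $ldes_F(g)=des_F(g)+csum(g)$, $finv_F(g)=r\,inv_F(g)+csum(g)$. -}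

module Defs where

open import Data.Nat using (ℕ; zero; suc; _+_; _*_; _<ᵇ_; _≡ᵇ_)
open import Data.Bool using (Bool; true; false; if_then_else_; _∧_; _∨_; not)
open import Data.Fin using (Fin; toℕ)
open import Data.Fin.Properties using (_≟_)
open import Data.Vec using (Vec; []; _∷_; lookup; tabulate; toList)
open import Data.List using (List; []; _∷_; map; concatMap; filter; length; allFin)
open import Data.Nat.ListAction using (sum)
open import Data.Product using (_×_; _,_; proj₁; proj₂)
open import Relation.Nullary.Decidable using (⌊_⌋)
open import Relation.Binary.PropositionalEquality using (_≡_)

allVecs : {A : Set} → (k : ℕ) → List A → List (Vec A k)
allVecs zero    xs = [] ∷ []
allVecs (suc k) xs = concatMap (λ x → map (x ∷_) (allVecs k xs)) xs

-- A permutation π ∈ S_n is stored as its one-line notation (π(1),…,π(n)),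
-- a vector of length n over Fin n with pairwise distinct entries.
anyL : {A : Set} → (A → Bool) → List A → Bool
anyL p []       = false
anyL p (x ∷ xs) = p x ∨ anyL p xs

allL : {A : Set} → (A → Bool) → List A → Bool
allL p []       = true
allL p (x ∷ xs) = p x ∧ allL p xs

isPerm : {n : ℕ} → Vec (Fin n) n → Bool
isPerm {n} v = allL (λ i → allL (λ j → ⌊ i ≟ j ⌋ ∨ not ⌊ lookup v i ≟ lookup v j ⌋) (allFin n)) (allFin n)

Sn : (n : ℕ) → List (Vec (Fin n) n)
Sn n = filter (λ v → isPerm v Data.Bool.≟ true) (allVecs n (allFin n))

-- Inverse permutation: π⁻¹(j) = the (unique) i with π(i) = j.
-- (The fallback value j is never used when v is a permutation.)
findIdx : {n : ℕ} → Vec (Fin n) n → Fin n → List (Fin n) → Fin n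
findIdx v j []       = j
findIdx v j (i ∷ is) = if ⌊ lookup v i ≟ j ⌋ then i else findIdx v j is

invPerm : {n : ℕ} → Vec (Fin n) n → Vec (Fin n) n
invPerm {n} v = tabulate (λ j → findIdx v j (allFin n))

-- Elements of the wreath product G_{r,n} = C_r ≀ S_n : pairs (z , π).
G : ℕ → ℕ → Set
G r n = Vec (Fin r) n × Vec (Fin n) n

allG : (r n : ℕ) → List (G r n)
allG r n = concatMap (λ z → map (z ,_) (Sn n)) (allVecs n (allFin r))

bar : {r n : ℕ} → G r n → G r n
bar (z , π) = (z , invPerm π)

csum : {r n : ℕ} → G r n → ℕ
csum (z , π) = sum (map toℕ (toList z))

-- Position in the friends order F of the letter i^{[c]} (with letters
-- 1..n encoded as Fin n values 0..n-1): 1 < 1^[1] < … < 1^[r-1] < 2 < …,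
-- i.e. i^{[c]} ↦ r·(i-1) + c.
fkey : (r : ℕ) {n : ℕ} → Fin n → Fin r → ℕ
fkey r i c = r * toℕ i + toℕ c

-- The colored word π(1)^{[z_1]} … π(n)^{[z_n]} as the list of F-keys.
word : {r n : ℕ} → G r n → List ℕ
word {r} (z , π) = toList (tabulate (λ k → fkey r (lookup π k) (lookup z k)))

-- Descent set as positions (1-based) i with w_i >_F w_{i+1}.
desPos : ℕ → List ℕ → List ℕ
desPos k []            = []
desPos k (x ∷ [])      = []
desPos k (x ∷ y ∷ ys)  = if y <ᵇ x then k ∷ desPos (suc k) (y ∷ ys) else desPos (suc k) (y ∷ ys)

desF : {r n : ℕ} → G r n → ℕ
desF g = length (desPos 1 (word g))

majF : {r n : ℕ} → G r n → ℕ
majF g = sum (desPos 1 (word g))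

invList : List ℕ → ℕ
invList []       = 0
invList (x ∷ xs) = length (filter (λ y → (y <ᵇ x) Data.Bool.≟ true) xs) + invList xs

invF : {r n : ℕ} → G r n → ℕ
invF g = invList (word g)

flagMajorF : {r n : ℕ} → G r n → ℕ
flagMajorF {r} g = r * majF g + csum g

ldesF : {r n : ℕ} → G r n → ℕ
ldesF g = desF g + csum g

finvF : {r n : ℕ} → G r n → ℕ
finvF {r} g = r * invF g + csum g

-- Coefficient of q^a t^b in the polynomial Σ_{g ∈ G_{r,n}} q^{f g} t^{h g}:
-- the number of g ∈ G_{r,n} with f g = a and h g = b.
coeff : (r n : ℕ) → (G r n → ℕ) → (G r n → ℕ) → ℕ → ℕ → ℕ
coeff r n f h a b = length (filter (λ g → ((f g ≡ᵇ a) ∧ (h g ≡ᵇ b)) Data.Bool.≟ true) (allG r n))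

{-# OPTIONS --safe #-}
-- For fixed colours z the F-keys r·π(k) + z_k compare exactly as the letters π(k) do, so
-- flag-major_F (z , π) = r·maj π + csum z and finv_F (z , π) = r·inv π + csum z, while
-- ldes_F (z , π⁻¹) depends only on z and on the set of letters i such that i + 1 precedes i in π.
-- Foata's bijection Φ of S_n satisfies inv (Φ π) = maj π and preserves that set: each of its steps
-- γ_x moves letters only inside blocks, keeping the relative order of the letters above x and of
-- those below x, and two consecutive letters different from x lie on the same side of x.  Hence
-- (z , π) ↦ (z , Φ π) is a bijection of G_{r,n} carrying flag-major_F to finv_F and fixing
-- ldes_F ∘ bar, so both polynomials have the same coefficients.

module Submission where

open import Defs
open import Data.Bool using (Bool; true; false; not; _∧_; _∨_; if_then_else_)
import Data.Bool as Bool
open import Data.Bool.Properties using (T-≡; not-involutive; not-injective)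
open import Data.Empty using (⊥)
open import Data.Fin using (Fin; zero; suc; toℕ; punchOut)
open import Data.Fin.Properties
  using (_≟_; toℕ-injective; toℕ<n; suc-injective; punchOut-injective; injective⇒≤; any?)
open import Data.List
  using (List; []; _∷_; _++_; _∷ʳ_; [_]; length; map; filter; reverse; concatMap;
         cartesianProductWith; cartesianProduct; allFin)
import Data.List as List
open import Data.List.Properties
  using (length-++; length-map; filter-++; filter-none; map-cong; ++-assoc; ++-identityʳ; map-++; unfold-reverse;
         reverse-involutive; reverse-injective; ∷ʳ-injective; ++-conicalʳ)
open import Data.List.Membership.Propositional using (_∈_)
open import Data.List.Membership.Propositional.Properties
  using (∈-∃++; ∈-map⁻; ∈-allFin; ∈-filter⁺; ∈-filter⁻;
         ∈-cartesianProductWith⁺; ∈-cartesianProduct⁺; ∈-cartesianProduct⁻)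
open import Data.List.Relation.Unary.Any using (here; there)
open import Data.List.Relation.Unary.All as All using (All; []; _∷_)
open import Data.List.Relation.Unary.All.Properties using (tabulate⁻; ∷ʳ⁺)
open import Data.List.Relation.Unary.AllPairs using ([]; _∷_)
open import Data.List.Relation.Unary.Unique.Propositional using (Unique)
import Data.List.Relation.Unary.Unique.Propositional.Properties as Unique
open import Data.List.Relation.Binary.Subset.Propositional using (_⊆_)
open import Data.List.Relation.Binary.Permutation.Propositional
  using (_↭_; ↭-refl; ↭-reflexive; ↭-sym; ↭-trans; ↭-prep; ↭⇒↭ₛ)
open import Data.List.Relation.Binary.Permutation.Propositional.Properties
  using (∈-resp-↭; All-resp-↭; ↭-length; shift; filter-↭; ++⁺ˡ; ++⁺ʳ; ∷↭∷ʳ; map⁺;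
         ↭-empty-inv; ↭-reverse)
import Data.List.Relation.Binary.Permutation.Setoid.Properties as PermutationSetoid
import Data.Nat as ℕ
open import Data.Nat using (ℕ; zero; suc; _+_; _*_; _<_; _≤_; _<ᵇ_; _≡ᵇ_; s≤s⁻¹)
open import Data.Nat.Properties
  using (≤-reflexive; +-suc; +-assoc; +-comm; +-identityʳ; *-zeroʳ; *-suc; <ᵇ⇒<; <⇒<ᵇ; ≮⇒≥; <-cmp;
         <-≤-trans; ≤-<-trans; <⇒≤; <-irrefl; <-trans; n<1+n; 1+n≰n; 1+n≢n; ≤∧≢⇒<;
         +-monoʳ-<; *-monoʳ-≤; m≤m+n; module ≤-Reasoning)
open import Data.Nat.ListAction using (sum)
open import Data.Nat.ListAction.Properties using (sum-↭)
open import Data.Nat.Solver using (module +-*-Solver)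
open import Data.Product using (_×_; _,_; ∃; proj₁; proj₂)
open import Data.Sum using (_⊎_; inj₁; inj₂)
open import Data.Vec using (Vec; []; _∷_; lookup; tabulate; toList; fromList; cast)
open import Data.Vec.Properties
  using (lookup∘tabulate; toList-cast; toList∘fromList; length-toList; cast-is-id; toList-injective)
import Data.Vec.Relation.Unary.All as Vec
open import Function using (_∘_; Equivalence)
open import Function.Definitions using (Injective)
open import Relation.Binary.Definitions using (DecidableEquality; tri<; tri≈; tri>)
open import Relation.Binary.PropositionalEquality
  using (_≡_; _≢_; refl; sym; trans; cong; cong₂; subst; setoid; module ≡-Reasoning)
open import Relation.Nullary using (contradiction; does; yes; no)
open import Relation.Nullary.Decidable using (⌊_⌋)

open +-*-Solver using (solve; _:+_; _:*_; _:=_)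

private variable
  A B C : Set
  k m n r : ℕ

<ᵇ≡true⇒< : ∀ {m n} → (m <ᵇ n) ≡ true → m < n
<ᵇ≡true⇒< {m} {n} eq = <ᵇ⇒< m n (Equivalence.from T-≡ eq)

<⇒<ᵇ≡true : ∀ {m n} → m < n → (m <ᵇ n) ≡ true
<⇒<ᵇ≡true m<n = Equivalence.to T-≡ (<⇒<ᵇ m<n)

<ᵇ≡false⇒≥ : ∀ {m n} → (m <ᵇ n) ≡ false → n ≤ m
<ᵇ≡false⇒≥ {m} {n} eq = ≮⇒≥ (λ m<n → contradiction (trans (sym eq) (<⇒<ᵇ≡true m<n)) λ ())

≥⇒<ᵇ≡false : ∀ {m n} → n ≤ m → (m <ᵇ n) ≡ false
≥⇒<ᵇ≡false {m} {n} n≤m with m <ᵇ n in eq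
... | false = refl
... | true  = contradiction (<-≤-trans (<ᵇ≡true⇒< eq) n≤m) (<-irrefl refl)

-- Counting in duplicate-free lists

select : (A → Bool) → List A → List A
select p = filter (λ x → p x Bool.≟ true)

count : (A → Bool) → List A → ℕ
count p xs = length (select p xs)

count-++ : ∀ (p : A → Bool) xs ys → count p (xs ++ ys) ≡ count p xs + count p ys
count-++ p xs ys = trans (cong length (filter-++ _ xs ys)) (length-++ (select p xs))

count-↭ : ∀ (p : A → Bool) {xs ys} → xs ↭ ys → count p xs ≡ count p ys
count-↭ p xs↭ys = ↭-length (filter-↭ _ xs↭ys)

select-cong-∈ : ∀ {p q : A → Bool} xs → (∀ {x} → x ∈ xs → p x ≡ q x) → select p xs ≡ select q xs
select-cong-∈ [] _ = refl
select-cong-∈ {p = p} {q} (x ∷ xs) p≗q with p x | q x | p≗q (here refl)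
... | true  | true  | _ = cong (x ∷_) (select-cong-∈ xs (λ y∈ → p≗q (there y∈)))
... | false | false | _ = select-cong-∈ xs (λ y∈ → p≗q (there y∈))

count-cong-∈ : ∀ {p q : A → Bool} xs → (∀ {x} → x ∈ xs → p x ≡ q x) → count p xs ≡ count q xs
count-cong-∈ xs p≗q = cong length (select-cong-∈ xs p≗q)

count-map : ∀ (p : A → Bool) (f : B → A) xs → count p (map f xs) ≡ count (λ x → p (f x)) xs
count-map p f [] = refl
count-map p f (x ∷ xs) with p (f x)
... | true  = cong suc (count-map p f xs)
... | false = count-map p f xs

⊆-length⇒↭ : ∀ {xs ys : List A} → Unique xs → xs ⊆ ys → length ys ≤ length xs → xs ↭ ys
⊆-length⇒↭ {xs = []} {ys = []}    _ _ _  = ↭-refl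
⊆-length⇒↭ {xs = []} {ys = _ ∷ _} _ _ ()
⊆-length⇒↭ {xs = x ∷ xs} (x∉xs ∷ xs!) xs⊆ys len with ∈-∃++ (xs⊆ys (here refl))
... | ys₁ , ys₂ , refl =
  ↭-trans (↭-prep x (⊆-length⇒↭ xs! xs⊆ys₁ys₂ len′)) (↭-sym (shift x ys₁ ys₂))
  where
  xs⊆ys₁ys₂ : xs ⊆ ys₁ ++ ys₂
  xs⊆ys₁ys₂ y∈xs with ∈-resp-↭ (shift x ys₁ ys₂) (xs⊆ys (there y∈xs))
  ... | here refl = contradiction refl (All.lookup x∉xs y∈xs)
  ... | there y∈  = y∈
  len′ : length (ys₁ ++ ys₂) ≤ length xs
  len′ = s≤s⁻¹ (subst (_≤ suc (length xs)) (↭-length (shift x ys₁ ys₂)) len)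

injection-map-↭ : ∀ {f : A → A} {xs} → Injective _≡_ _≡_ f → Unique xs →
                  (∀ {x} → x ∈ xs → f x ∈ xs) → map f xs ↭ xs
injection-map-↭ {f = f} {xs} f-inj xs! f-into =
  ⊆-length⇒↭ (Unique.map⁺ f-inj xs!) f∈ (≤-reflexive (sym (length-map f xs)))
  where
  f∈ : map f xs ⊆ xs
  f∈ y∈ with ∈-map⁻ f y∈
  ... | x , x∈ , refl = f-into x∈

count-reindex : ∀ (p : A → Bool) {f : A → A} {xs} → Injective _≡_ _≡_ f → Unique xs →
                (∀ {x} → x ∈ xs → f x ∈ xs) → count p xs ≡ count (λ x → p (f x)) xs
count-reindex p {f} {xs} f-inj xs! f-into =
  trans (count-↭ p (↭-sym (injection-map-↭ f-inj xs! f-into))) (count-map p f xs)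

count-true : ∀ (p : A → Bool) {xs} → All (λ x → p x ≡ true) xs → count p xs ≡ length xs
count-true p []           = refl
count-true p (px ∷ pxs) rewrite px = cong suc (count-true p pxs)

count-false : ∀ (p : A → Bool) {xs} → All (λ x → p x ≡ false) xs → count p xs ≡ 0
count-false p []           = refl
count-false p (px ∷ pxs) rewrite px = count-false p pxs

count-not+count : ∀ (p : A → Bool) xs → count (λ x → not (p x)) xs + count p xs ≡ length xs
count-not+count p []       = refl
count-not+count p (x ∷ xs) with p x
... | true  = trans (+-suc _ _) (cong suc (count-not+count p xs))
... | false = cong suc (count-not+count p xs)

Unique-resp-↭ : ∀ {xs ys : List A} → xs ↭ ys → Unique xs → Unique ys
Unique-resp-↭ {A = A} xs↭ys = PermutationSetoid.Unique-resp-↭ (setoid A) (↭⇒↭ₛ xs↭ys)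

concatMap-map : (f : A → B → C) (xs : List A) (ys : List B) →
                concatMap (λ x → map (f x) ys) xs ≡ cartesianProductWith f xs ys
concatMap-map f []       ys = refl
concatMap-map f (x ∷ xs) ys = cong (map (f x) ys ++_) (concatMap-map f xs ys)

allVecs-suc : ∀ k (xs : List A) → allVecs (suc k) xs ≡ cartesianProductWith _∷_ xs (allVecs k xs)
allVecs-suc k xs = concatMap-map _∷_ xs (allVecs k xs)

allVecs-unique : ∀ k {xs : List A} → Unique xs → Unique (allVecs k xs)
allVecs-unique zero    _   = [] ∷ []
allVecs-unique (suc k) {xs} xs! rewrite allVecs-suc k xs =
  Unique.cartesianProductWith⁺ _∷_ (λ { refl → refl , refl }) xs! (allVecs-unique k xs!)

∈-allVecs : ∀ {xs : List A} {v : Vec A k} → Vec.All (_∈ xs) v → v ∈ allVecs k xs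
∈-allVecs Vec.[] = here refl
∈-allVecs {k = suc k} {xs} (x∈ Vec.∷ v∈) rewrite allVecs-suc k xs =
  ∈-cartesianProductWith⁺ _∷_ x∈ (∈-allVecs v∈)

allL⇒All : ∀ (p : A → Bool) xs → allL p xs ≡ true → All (λ x → p x ≡ true) xs
allL⇒All p []       _  = []
allL⇒All p (x ∷ xs) eq with p x in px
... | true = px ∷ allL⇒All p xs eq

All⇒allL : ∀ (p : A → Bool) {xs} → All (λ x → p x ≡ true) xs → allL p xs ≡ true
All⇒allL p []           = refl
All⇒allL p (px ∷ pxs) rewrite px = All⇒allL p pxs

isPerm⇒injective : (v : Vec (Fin n) n) → isPerm v ≡ true → Injective _≡_ _≡_ (lookup v)
isPerm⇒injective {n} v perm {i} {j} vi≡vj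
  with All.lookup (allL⇒All _ _ (All.lookup (allL⇒All _ (allFin n) perm) (∈-allFin i))) (∈-allFin j)
... | distinct with i ≟ j
... | yes i≡j = i≡j
... | no _ with lookup v i ≟ lookup v j
... | yes _    = contradiction distinct λ ()
... | no vi≢vj = contradiction vi≡vj vi≢vj

injective⇒isPerm : (v : Vec (Fin n) n) → Injective _≡_ _≡_ (lookup v) → isPerm v ≡ true
injective⇒isPerm {n} v inj =
  All⇒allL _ (All.universal (λ i → All⇒allL _ (All.universal (distinct i) (allFin n))) (allFin n))
  where
  distinct : ∀ i j → (⌊ i ≟ j ⌋ ∨ not ⌊ lookup v i ≟ lookup v j ⌋) ≡ true
  distinct i j with i ≟ j
  ... | yes _ = refl
  ... | no i≢j with lookup v i ≟ lookup v j
  ... | yes vi≡vj = contradiction (inj vi≡vj) i≢j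
  ... | no _      = refl

toList≡tabulate : (v : Vec A m) → toList v ≡ List.tabulate (lookup v)
toList≡tabulate []       = refl
toList≡tabulate (x ∷ v) = cong (x ∷_) (toList≡tabulate v)

injective⇒unique : (v : Vec A m) → Injective _≡_ _≡_ (lookup v) → Unique (toList v)
injective⇒unique v inj rewrite toList≡tabulate v = Unique.tabulate⁺ inj

unique⇒injective : (v : Vec A m) → Unique (toList v) → Injective _≡_ _≡_ (lookup v)
unique⇒injective v v! = tabulate-injective (subst Unique (toList≡tabulate v) v!)
  where
  tabulate-injective : ∀ {m} {f : Fin m → A} → Unique (List.tabulate f) → Injective _≡_ _≡_ f
  tabulate-injective _         {zero}  {zero}  _  = refl
  tabulate-injective (f0∉ ∷ _) {zero}  {suc j} eq = contradiction eq (tabulate⁻ f0∉ j)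
  tabulate-injective (f0∉ ∷ _) {suc i} {zero}  eq = contradiction (sym eq) (tabulate⁻ f0∉ i)
  tabulate-injective (_ ∷ f!)  {suc i} {suc j} eq = cong suc (tabulate-injective f! eq)

injective⇒surjective : (v : Vec (Fin n) n) → Injective _≡_ _≡_ (lookup v) →
                       ∀ a → ∃ λ i → lookup v i ≡ a
injective⇒surjective {suc m} v inj a with any? (λ i → lookup v i ≟ a)
... | yes hit  = hit
... | no  miss = contradiction (injective⇒≤ punched-injective) 1+n≰n
  where
  missed : ∀ i → a ≢ lookup v i
  missed i a≡vi = miss (i , sym a≡vi)
  punched-injective : Injective _≡_ _≡_ (λ i → punchOut (missed i))
  punched-injective eq = inj (punchOut-injective (missed _) (missed _) eq)

lookup-findIdx : (v : Vec (Fin n) n) (a : Fin n) (is : List (Fin n)) →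
                 (∃ λ i → i ∈ is × lookup v i ≡ a) → lookup v (findIdx v a is) ≡ a
lookup-findIdx v a (i ∷ is) hit with lookup v i ≟ a | hit
... | yes vi≡a | _                  = vi≡a
... | no  vi≢a | _ , here refl , vi≡a = contradiction vi≡a vi≢a
... | no  _    | j , there j∈ , vj≡a  = lookup-findIdx v a is (j , j∈ , vj≡a)

lookup-invPerm : (v : Vec (Fin n) n) → Injective _≡_ _≡_ (lookup v) →
                 ∀ a → lookup v (lookup (invPerm v) a) ≡ a
lookup-invPerm {n} v inj a with i , vi≡a ← injective⇒surjective v inj a
  rewrite lookup∘tabulate (λ b → findIdx v b (allFin n)) a =
  lookup-findIdx v a (allFin n) (i , ∈-allFin i , vi≡a)

Sn-unique : ∀ n → Unique (Sn n)
Sn-unique n = Unique.filter⁺ _ (allVecs-unique n (Unique.allFin⁺ n))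

∈-Sn⁻ : ∀ {π : Vec (Fin n) n} → π ∈ Sn n → isPerm π ≡ true
∈-Sn⁻ {n} π∈ = proj₂ (∈-filter⁻ (λ v → isPerm v Bool.≟ true) {xs = allVecs n (allFin n)} π∈)

∈-Sn⁺ : ∀ {π : Vec (Fin n) n} → isPerm π ≡ true → π ∈ Sn n
∈-Sn⁺ perm = ∈-filter⁺ (λ v → isPerm v Bool.≟ true) (∈-allVecs (Vec.universal ∈-allFin _)) perm

allG≡cartesianProduct : ∀ r n → allG r n ≡ cartesianProduct (allVecs n (allFin r)) (Sn n)
allG≡cartesianProduct r n = concatMap-map _,_ (allVecs n (allFin r)) (Sn n)

allG-unique : ∀ r n → Unique (allG r n)
allG-unique r n rewrite allG≡cartesianProduct r n =
  Unique.cartesianProduct⁺ (allVecs-unique n (Unique.allFin⁺ r)) (Sn-unique n)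

∈-allG⇒isPerm : ∀ {r} {z : Vec (Fin r) n} {π} → (z , π) ∈ allG r n → isPerm π ≡ true
∈-allG⇒isPerm {n} {r} g∈ rewrite allG≡cartesianProduct r n =
  ∈-Sn⁻ (proj₂ (∈-cartesianProduct⁻ (allVecs n (allFin r)) (Sn n) g∈))

∈-allG-map : ∀ {r} (φ : Vec (Fin n) n → Vec (Fin n) n) →
             (∀ π → isPerm π ≡ true → isPerm (φ π) ≡ true) →
             ∀ {z : Vec (Fin r) n} {π} → (z , π) ∈ allG r n → (z , φ π) ∈ allG r n
∈-allG-map {n} {r} φ φ-perm g∈ rewrite allG≡cartesianProduct r n
  with z∈ , π∈ ← ∈-cartesianProduct⁻ (allVecs n (allFin r)) (Sn n) g∈ =
  ∈-cartesianProduct⁺ z∈ (∈-Sn⁺ (φ-perm _ (∈-Sn⁻ π∈)))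

-- Foata's bijection

endsWith : (A → Bool) → List A → Bool
endsWith p []           = true
endsWith p (y ∷ [])     = p y
endsWith p (y ∷ z ∷ zs) = endsWith p (z ∷ zs)

startsWith : (A → Bool) → List A → Bool
startsWith p []      = true
startsWith p (y ∷ _) = p y

endsWith-∷ʳ : ∀ (p : A → Bool) xs y → endsWith p (xs ∷ʳ y) ≡ p y
endsWith-∷ʳ p []           y = refl
endsWith-∷ʳ p (x ∷ [])     y = refl
endsWith-∷ʳ p (x ∷ z ∷ zs) y = endsWith-∷ʳ p (z ∷ zs) y

endsWith-++ : ∀ (p : A → Bool) xs y ys → endsWith p (xs ++ y ∷ ys) ≡ endsWith p (y ∷ ys)
endsWith-++ p []           y ys = refl
endsWith-++ p (x ∷ [])     y ys = refl
endsWith-++ p (x ∷ z ∷ zs) y ys = endsWith-++ p (z ∷ zs) y ys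

endsWith-∷ : ∀ (p : A → Bool) y ys → endsWith p (y ∷ ys) ≡ true → endsWith p ys ≡ true
endsWith-∷ p y []       _    = refl
endsWith-∷ p y (z ∷ zs) ends = ends

endsWith-map : ∀ {B : Set} (p : B → Bool) (f : A → B) xs → endsWith p (map f xs) ≡ endsWith (p ∘ f) xs
endsWith-map p f []           = refl
endsWith-map p f (x ∷ [])     = refl
endsWith-map p f (x ∷ z ∷ zs) = endsWith-map p f (z ∷ zs)

endsWith-not : ∀ (p : A → Bool) xs → endsWith p xs ≡ false → endsWith (not ∘ p) xs ≡ true
endsWith-not p (x ∷ [])     px   rewrite px = refl
endsWith-not p (x ∷ z ∷ zs) ends = endsWith-not p (z ∷ zs) ends

endsWith-none : ∀ (p : A → Bool) {xs} → All (λ x → p x ≡ false) xs → endsWith p xs ≡ true → xs ≡ []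
endsWith-none p []                    _    = refl
endsWith-none p (px ∷ [])             ends = contradiction (trans (sym px) ends) λ ()
endsWith-none p (_ ∷ pxs@(_ ∷ _))     ends with () ← endsWith-none p pxs ends

sum-desPos-∷ʳ : ∀ k m ms c → sum (desPos k ((m ∷ ms) ∷ʳ c)) ≡
                sum (desPos k (m ∷ ms)) + (if endsWith (c <ᵇ_) (m ∷ ms) then k + length ms else 0)
sum-desPos-∷ʳ k m [] c with c <ᵇ m
... | true  = refl
... | false = refl
sum-desPos-∷ʳ k m (m′ ∷ ms) c rewrite +-suc k (length ms) with m′ <ᵇ m
... | true  = trans (cong (k +_) (sum-desPos-∷ʳ (suc k) m′ ms c)) (sym (+-assoc k _ _))
... | false = sum-desPos-∷ʳ (suc k) m′ ms c

-- Foata's γ: cut the word after every letter satisfying p and move that letter to the front of its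
-- block; acc is the unfinished block.
rotateBlocks : (A → Bool) → List A → List A → List A
rotateBlocks p acc []       = acc
rotateBlocks p acc (y ∷ ys) = if p y then y ∷ acc ++ rotateBlocks p [] ys else rotateBlocks p (acc ∷ʳ y) ys

rotateBlocks-↭ : ∀ (p : A → Bool) acc ys → rotateBlocks p acc ys ↭ acc ++ ys
rotateBlocks-↭ p acc []       = ↭-reflexive (sym (++-identityʳ acc))
rotateBlocks-↭ p acc (y ∷ ys) with p y
... | true  = ↭-trans (↭-prep y (++⁺ˡ acc (rotateBlocks-↭ p [] ys))) (↭-sym (shift y acc ys))
... | false = subst (rotateBlocks p (acc ∷ʳ y) ys ↭_) (++-assoc acc [ y ] ys) (rotateBlocks-↭ p (acc ∷ʳ y) ys)

unrotateFrom : (A → Bool) → A → List A → List A → List A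
unrotateFrom p y acc []       = acc ∷ʳ y
unrotateFrom p y acc (w ∷ ws) =
  if p w then (acc ∷ʳ y) ++ unrotateFrom p w [] ws else unrotateFrom p y (acc ∷ʳ w) ws

unrotate : (A → Bool) → List A → List A
unrotate p []       = []
unrotate p (w ∷ ws) = unrotateFrom p w [] ws

unrotateFrom-++ : ∀ (p : A → Bool) y acc {as} ws → All (λ a → p a ≡ false) as →
                  unrotateFrom p y acc (as ++ ws) ≡ unrotateFrom p y (acc ++ as) ws
unrotateFrom-++ p y acc ws [] = cong (λ l → unrotateFrom p y l ws) (sym (++-identityʳ acc))
unrotateFrom-++ p y acc {a ∷ as} ws (pa ∷ pas) rewrite pa =
  trans (unrotateFrom-++ p y (acc ∷ʳ a) ws pas) (cong (λ l → unrotateFrom p y l ws) (++-assoc acc [ a ] as))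

unrotateFrom-startsWith : ∀ (p : A → Bool) y acc ws → startsWith p ws ≡ true →
                          unrotateFrom p y acc ws ≡ (acc ∷ʳ y) ++ unrotate p ws
unrotateFrom-startsWith p y acc []       _  = sym (++-identityʳ (acc ∷ʳ y))
unrotateFrom-startsWith p y acc (w ∷ ws) pw rewrite pw = refl

rotateBlocks-startsWith : ∀ (p : A → Bool) acc ys → All (λ a → p a ≡ false) acc →
                          endsWith p (acc ++ ys) ≡ true → startsWith p (rotateBlocks p acc ys) ≡ true
rotateBlocks-startsWith p acc [] acc¬p ends
  with refl ← endsWith-none p acc¬p (subst (λ l → endsWith p l ≡ true) (++-identityʳ acc) ends) = refl
rotateBlocks-startsWith p acc (y ∷ ys) acc¬p ends with p y in py
... | true = py
... | false rewrite sym (++-assoc acc [ y ] ys) = rotateBlocks-startsWith p (acc ∷ʳ y) ys (∷ʳ⁺ acc¬p py) ends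

unrotate-rotateBlocks : ∀ (p : A → Bool) acc ys → All (λ a → p a ≡ false) acc →
                        endsWith p (acc ++ ys) ≡ true → unrotate p (rotateBlocks p acc ys) ≡ acc ++ ys
unrotate-rotateBlocks p acc [] acc¬p ends
  with refl ← endsWith-none p acc¬p (subst (λ l → endsWith p l ≡ true) (++-identityʳ acc) ends) = refl
unrotate-rotateBlocks p acc (y ∷ ys) acc¬p ends with p y in py
... | false rewrite sym (++-assoc acc [ y ] ys) = unrotate-rotateBlocks p (acc ∷ʳ y) ys (∷ʳ⁺ acc¬p py) ends
... | true = begin
  unrotateFrom p y [] (acc ++ γ)  ≡⟨ unrotateFrom-++ p y [] γ acc¬p ⟩
  unrotateFrom p y acc γ          ≡⟨ unrotateFrom-startsWith p y acc γ (rotateBlocks-startsWith p [] ys [] ys-ends) ⟩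
  (acc ∷ʳ y) ++ unrotate p γ      ≡⟨ cong ((acc ∷ʳ y) ++_) (unrotate-rotateBlocks p [] ys [] ys-ends) ⟩
  (acc ∷ʳ y) ++ ys                ≡⟨ ++-assoc acc [ y ] ys ⟩
  acc ++ y ∷ ys                   ∎
  where
  open ≡-Reasoning
  γ = rotateBlocks p [] ys
  ys-ends : endsWith p ys ≡ true
  ys-ends = endsWith-∷ p y ys (trans (sym (endsWith-++ p acc y ys)) ends)

select-rotateBlocks : ∀ (p q : A → Bool) →
                      (∀ {a y} → p a ≡ false → p y ≡ true → q a ≡ false ⊎ q y ≡ false) →
                      ∀ acc ys → All (λ a → p a ≡ false) acc →
                      select q (rotateBlocks p acc ys) ≡ select q (acc ++ ys)
select-rotateBlocks p q separated acc [] _ = cong (select q) (sym (++-identityʳ acc))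
select-rotateBlocks p q separated acc (y ∷ ys) acc¬p with p y in py
... | false rewrite sym (++-assoc acc [ y ] ys) = select-rotateBlocks p q separated (acc ∷ʳ y) ys (∷ʳ⁺ acc¬p py)
... | true = begin
  select q ((y ∷ acc) ++ γ)              ≡⟨ filter-++ _ (y ∷ acc) γ ⟩
  select q (y ∷ acc) ++ select q γ      ≡⟨ cong₂ _++_ rotated (select-rotateBlocks p q separated [] ys []) ⟩
  select q (acc ∷ʳ y) ++ select q ys    ≡⟨ filter-++ _ (acc ∷ʳ y) ys ⟨
  select q ((acc ∷ʳ y) ++ ys)           ≡⟨ cong (select q) (++-assoc acc [ y ] ys) ⟩
  select q (acc ++ y ∷ ys)              ∎
  where
  open ≡-Reasoning
  γ = rotateBlocks p [] ys
  excluded : q y ≡ true → ∀ {a} → p a ≡ false → q a ≡ true → ⊥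
  excluded qy pa qa with separated pa py
  ... | inj₁ qa≡false = contradiction (trans (sym qa) qa≡false) λ ()
  ... | inj₂ qy≡false = contradiction (trans (sym qy) qy≡false) λ ()
  rotated : select q (y ∷ acc) ≡ select q (acc ∷ʳ y)
  rotated rewrite filter-++ (λ x → q x Bool.≟ true) acc [ y ] with q y in qy
  ... | false = sym (++-identityʳ (select q acc))
  ... | true rewrite filter-none (λ x → q x Bool.≟ true) (All.map (excluded qy) acc¬p) = refl

module Foata {A : Set} (κ : A → ℕ) where

  _≺_ : A → A → Bool
  a ≺ b = κ a <ᵇ κ b

  inv : List A → ℕ
  inv w = invList (map κ w)

  maj : List A → ℕ
  maj w = sum (desPos 1 (map κ w))

  cross : List A → List A → ℕ
  cross xs ys = sum (map (λ x → count (_≺ x) ys) xs)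

  inv-∷ : ∀ x xs → inv (x ∷ xs) ≡ count (_≺ x) xs + inv xs
  inv-∷ x xs = cong (_+ inv xs) (count-map (_<ᵇ κ x) κ xs)

  inv-++ : ∀ xs ys → inv (xs ++ ys) ≡ inv xs + inv ys + cross xs ys
  inv-++ []       ys = sym (+-identityʳ (inv ys))
  inv-++ (x ∷ xs) ys = begin
    inv (x ∷ xs ++ ys)
      ≡⟨ inv-∷ x (xs ++ ys) ⟩
    count (_≺ x) (xs ++ ys) + inv (xs ++ ys)
      ≡⟨ cong₂ _+_ (count-++ (_≺ x) xs ys) (inv-++ xs ys) ⟩
    (count (_≺ x) xs + count (_≺ x) ys) + (inv xs + inv ys + cross xs ys)
      ≡⟨ solve 5 (λ a b c d e → (a :+ b) :+ (c :+ d :+ e) := a :+ c :+ d :+ (b :+ e)) refl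
           (count (_≺ x) xs) (count (_≺ x) ys) (inv xs) (inv ys) (cross xs ys) ⟩
    count (_≺ x) xs + inv xs + inv ys + cross (x ∷ xs) ys
      ≡⟨ cong (λ i → i + inv ys + cross (x ∷ xs) ys) (inv-∷ x xs) ⟨
    inv (x ∷ xs) + inv ys + cross (x ∷ xs) ys
      ∎
    where open ≡-Reasoning

  inv-∷ʳ : ∀ xs y → inv (xs ∷ʳ y) ≡ inv xs + count (y ≺_) xs
  inv-∷ʳ xs y = trans (inv-++ xs [ y ]) (cong₂ _+_ (+-identityʳ (inv xs)) (cross-[ y ] xs))
    where
    cross-[_] : ∀ y xs → cross xs [ y ] ≡ count (y ≺_) xs
    cross-[ y ] [] = refl
    cross-[ y ] (x ∷ xs) with y ≺ x
    ... | true  = cong suc (cross-[ y ] xs)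
    ... | false = cross-[ y ] xs

  cross-↭ : ∀ {xs xs′ ys ys′} → xs ↭ xs′ → ys ↭ ys′ → cross xs ys ≡ cross xs′ ys′
  cross-↭ {xs′ = xs′} xs↭xs′ ys↭ys′ =
    trans (sum-↭ (map⁺ _ xs↭xs′)) (cong sum (map-cong (λ x → count-↭ (_≺ x) ys↭ys′) xs′))

  inv-rotate : ∀ y xs → inv (y ∷ xs) + count (y ≺_) xs ≡ inv (xs ∷ʳ y) + count (_≺ y) xs
  inv-rotate y xs = begin
    inv (y ∷ xs) + count (y ≺_) xs                  ≡⟨ cong (_+ count (y ≺_) xs) (inv-∷ y xs) ⟩
    count (_≺ y) xs + inv xs + count (y ≺_) xs      ≡⟨ solve 3 (λ a b c → a :+ b :+ c := b :+ c :+ a) refl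
                                                         (count (_≺ y) xs) (inv xs) (count (y ≺_) xs) ⟩
    inv xs + count (y ≺_) xs + count (_≺ y) xs      ≡⟨ cong (_+ count (_≺ y) xs) (inv-∷ʳ xs y) ⟨
    inv (xs ∷ʳ y) + count (_≺ y) xs                 ∎
    where open ≡-Reasoning

  -- d (resp. e) is 1 when the letter closing a block lies above (resp. below) the rest of the block.
  module _ (p : A → Bool) (d e : ℕ)
    (block : ∀ {acc y} → All (λ a → p a ≡ false) acc → p y ≡ true →
             count (y ≺_) acc ≡ e * length acc × count (_≺ y) acc ≡ d * length acc) where

    inv-rotateBlocks : ∀ acc ys → All (λ a → p a ≡ false) acc → endsWith p (acc ++ ys) ≡ true →
      inv (rotateBlocks p acc ys) + e * count (not ∘ p) (acc ++ ys) ≡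
      inv (acc ++ ys) + d * count (not ∘ p) (acc ++ ys)
    inv-rotateBlocks acc [] acc¬p ends
      with refl ← endsWith-none p acc¬p (subst (λ l → endsWith p l ≡ true) (++-identityʳ acc) ends) =
      trans (*-zeroʳ e) (sym (*-zeroʳ d))
    inv-rotateBlocks acc (y ∷ ys) acc¬p ends with p y in py
    ... | false rewrite sym (++-assoc acc [ y ] ys) =
      inv-rotateBlocks (acc ∷ʳ y) ys (∷ʳ⁺ acc¬p py) ends
    ... | true = begin
      inv ((y ∷ acc) ++ γ) + e * count (not ∘ p) (acc ++ y ∷ ys)
        ≡⟨ cong₂ _+_ (inv-++ (y ∷ acc) γ) (cong (e *_) N≡) ⟩
      inv (y ∷ acc) + inv γ + cross (y ∷ acc) γ + e * (L + N)
        ≡⟨ regroup (inv (y ∷ acc)) (inv γ) _ e L N ⟩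
      (inv (y ∷ acc) + e * L) + (inv γ + e * N) + cross (y ∷ acc) γ
        ≡⟨ cong₂ _+_ (cong₂ _+_ rotated ih) (cross-↭ (∷↭∷ʳ y acc) (rotateBlocks-↭ p [] ys)) ⟩
      (inv (acc ∷ʳ y) + d * L) + (inv ys + d * N) + cross (acc ∷ʳ y) ys
        ≡⟨ regroup (inv (acc ∷ʳ y)) (inv ys) _ d L N ⟨
      inv (acc ∷ʳ y) + inv ys + cross (acc ∷ʳ y) ys + d * (L + N)
        ≡⟨ cong₂ _+_ (trans (sym (inv-++ (acc ∷ʳ y) ys)) (cong inv (++-assoc acc [ y ] ys)))
                     (cong (d *_) (sym N≡)) ⟩
      inv (acc ++ y ∷ ys) + d * count (not ∘ p) (acc ++ y ∷ ys) ∎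
      where
      open ≡-Reasoning
      γ = rotateBlocks p [] ys
      L = length acc
      N = count (not ∘ p) ys
      N≡ : count (not ∘ p) (acc ++ y ∷ ys) ≡ L + N
      N≡ rewrite count-++ (not ∘ p) acc (y ∷ ys) | py =
        cong (_+ N) (count-true (not ∘ p) (All.map (cong not) acc¬p))
      ih : inv γ + e * N ≡ inv ys + d * N
      ih = inv-rotateBlocks [] ys [] (endsWith-∷ p y ys (trans (sym (endsWith-++ p acc y ys)) ends))
      rotated : inv (y ∷ acc) + e * L ≡ inv (acc ∷ʳ y) + d * L
      rotated with block acc¬p py
      ... | above , below rewrite sym above | sym below = inv-rotate y acc
      regroup : ∀ a b c k l n → a + b + c + k * (l + n) ≡ (a + k * l) + (b + k * n) + c
      regroup = solve 6 (λ a b c k l n → a :+ b :+ c :+ k :* (l :+ n) := (a :+ k :* l) :+ (b :+ k :* n) :+ c) refl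

  foataStep : A → List A → List A
  foataStep x u = if endsWith (x ≺_) u then rotateBlocks (x ≺_) [] u else rotateBlocks (not ∘ (x ≺_)) [] u

  -- foata reads the word from its last letter, so it is fed the reversed word (see foataWord).
  foata : List A → List A
  foata []      = []
  foata (x ∷ w) = foataStep x (foata w) ∷ʳ x

  foataStep-↭ : ∀ x u → foataStep x u ↭ u
  foataStep-↭ x u with endsWith (x ≺_) u
  ... | true  = rotateBlocks-↭ _ [] u
  ... | false = rotateBlocks-↭ _ [] u

  foata-↭ : ∀ w → foata w ↭ reverse w
  foata-↭ []      = ↭-refl
  foata-↭ (x ∷ w) rewrite unfold-reverse x w = ++⁺ʳ [ x ] (↭-trans (foataStep-↭ x (foata w)) (foata-↭ w))

  endsWith-foata : ∀ q w → endsWith q (foata w) ≡ endsWith q (reverse w)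
  endsWith-foata q []      = refl
  endsWith-foata q (x ∷ w) rewrite unfold-reverse x w =
    trans (endsWith-∷ʳ q (foataStep x (foata w)) x) (sym (endsWith-∷ʳ q (reverse w) x))

  closing-letter-above : ∀ x {acc y} → All (λ a → (x ≺ a) ≡ false) acc → (x ≺ y) ≡ true →
                         count (y ≺_) acc ≡ 0 * length acc × count (_≺ y) acc ≡ 1 * length acc
  closing-letter-above x {acc} {y} acc≤x x<y =
      count-false (y ≺_) (All.map (λ a≤x → ≥⇒<ᵇ≡false (<⇒≤ (a<y a≤x))) acc≤x)
    , trans (count-true (_≺ y) (All.map (λ a≤x → <⇒<ᵇ≡true (a<y a≤x)) acc≤x)) (sym (+-identityʳ _))
    where
    a<y : ∀ {a} → (x ≺ a) ≡ false → κ a < κ y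
    a<y a≤x = ≤-<-trans (<ᵇ≡false⇒≥ a≤x) (<ᵇ≡true⇒< x<y)

  closing-letter-below : ∀ x {acc y} → All (λ a → not (x ≺ a) ≡ false) acc → not (x ≺ y) ≡ true →
                         count (y ≺_) acc ≡ 1 * length acc × count (_≺ y) acc ≡ 0 * length acc
  closing-letter-below x {acc} {y} acc>x y≤x =
      trans (count-true (y ≺_) (All.map (λ a>x → <⇒<ᵇ≡true (y<a a>x)) acc>x)) (sym (+-identityʳ _))
    , count-false (_≺ y) (All.map (λ a>x → ≥⇒<ᵇ≡false (<⇒≤ (y<a a>x))) acc>x)
    where
    y<a : ∀ {a} → not (x ≺ a) ≡ false → κ y < κ a
    y<a a>x = ≤-<-trans (<ᵇ≡false⇒≥ (not-injective y≤x)) (<ᵇ≡true⇒< (not-injective a>x))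

  inv-foataStep : ∀ x u → inv (foataStep x u ∷ʳ x) ≡ inv u + (if endsWith (x ≺_) u then length u else 0)
  inv-foataStep x u rewrite inv-∷ʳ (foataStep x u) x | count-↭ (x ≺_) (foataStep-↭ x u)
    with endsWith (x ≺_) u in ends
  ... | true = begin
    inv γ + count (x ≺_) u               ≡⟨ cong (_+ count (x ≺_) u) (sym (+-identityʳ (inv γ))) ⟩
    inv γ + 0 + count (x ≺_) u
      ≡⟨ cong (_+ count (x ≺_) u) (inv-rotateBlocks (x ≺_) 1 0 (closing-letter-above x) [] u [] ends) ⟩
    inv u + (N + 0) + count (x ≺_) u     ≡⟨ cong (λ n → inv u + n + count (x ≺_) u) (+-identityʳ N) ⟩
    inv u + N + count (x ≺_) u           ≡⟨ +-assoc (inv u) N _ ⟩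
    inv u + (N + count (x ≺_) u)         ≡⟨ cong (inv u +_) (count-not+count (x ≺_) u) ⟩
    inv u + length u                     ∎
    where
    open ≡-Reasoning
    γ = rotateBlocks (x ≺_) [] u
    N = count (not ∘ (x ≺_)) u
  ... | false = begin
    inv γ + count (x ≺_) u               ≡⟨ cong (inv γ +_) (count-cong-∈ u (λ _ → sym (not-involutive _))) ⟩
    inv γ + count (not ∘ not ∘ (x ≺_)) u ≡⟨ cong (inv γ +_) (sym (+-identityʳ _)) ⟩
    inv γ + 1 * count (not ∘ not ∘ (x ≺_)) u
      ≡⟨ inv-rotateBlocks (not ∘ (x ≺_)) 0 1 (closing-letter-below x) [] u [] (endsWith-not (x ≺_) u ends) ⟩
    inv u + 0                            ∎
    where
    open ≡-Reasoning
    γ = rotateBlocks (not ∘ (x ≺_)) [] u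

  maj-∷ʳ : ∀ w x → maj (w ∷ʳ x) ≡ maj w + (if endsWith (x ≺_) w then length w else 0)
  maj-∷ʳ []      x = refl
  maj-∷ʳ (y ∷ w) x rewrite map-++ κ (y ∷ w) [ x ] | sum-desPos-∷ʳ 1 (κ y) (map κ w) (κ x)
                         | endsWith-map (κ x <ᵇ_) κ (y ∷ w) | length-map κ w = refl

  inv-foata : ∀ w → inv (foata w) ≡ maj (reverse w)
  inv-foata []      = refl
  inv-foata (x ∷ w) = begin
    inv (foataStep x (foata w) ∷ʳ x)
      ≡⟨ inv-foataStep x (foata w) ⟩
    inv (foata w) + (if endsWith (x ≺_) (foata w) then length (foata w) else 0)
      ≡⟨ cong₂ _+_ (inv-foata w)
                   (cong₂ (λ b l → if b then l else 0) (endsWith-foata (x ≺_) w) (↭-length (foata-↭ w))) ⟩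
    maj (reverse w) + (if endsWith (x ≺_) (reverse w) then length (reverse w) else 0)
      ≡⟨ maj-∷ʳ (reverse w) x ⟨
    maj (reverse w ∷ʳ x)
      ≡⟨ cong maj (unfold-reverse x w) ⟨
    maj (reverse (x ∷ w))  ∎
    where open ≡-Reasoning

  unfoataStep : A → List A → List A
  unfoataStep x w = if startsWith (x ≺_) w then unrotate (x ≺_) w else unrotate (not ∘ (x ≺_)) w

  unfoataStep-foataStep : ∀ x u → unfoataStep x (foataStep x u) ≡ u
  unfoataStep-foataStep x u with endsWith (x ≺_) u in ends
  ... | true rewrite rotateBlocks-startsWith (x ≺_) [] u [] ends = unrotate-rotateBlocks (x ≺_) [] u [] ends
  ... | false
    with rotateBlocks (not ∘ (x ≺_)) [] u
       | rotateBlocks-↭ (not ∘ (x ≺_)) [] u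
       | rotateBlocks-startsWith (not ∘ (x ≺_)) [] u [] (endsWith-not (x ≺_) u ends)
       | unrotate-rotateBlocks (not ∘ (x ≺_)) [] u [] (endsWith-not (x ≺_) u ends)
  ... | []    | γ↭u | _      | _ with refl ← ↭-empty-inv (↭-sym γ↭u) = contradiction ends λ ()
  ... | h ∷ _ | _   | h≤x | undone rewrite not-injective h≤x = undone

  foata-injective : ∀ {v w} → foata v ≡ foata w → v ≡ w
  foata-injective {[]}    {[]}    _  = refl
  foata-injective {[]}    {x ∷ w} eq with () ← ++-conicalʳ (foataStep x (foata w)) [ x ] (sym eq)
  foata-injective {x ∷ v} {[]}    eq with () ← ++-conicalʳ (foataStep x (foata v)) [ x ] eq
  foata-injective {x ∷ v} {y ∷ w} eq with ∷ʳ-injective (foataStep x (foata v)) (foataStep y (foata w)) eq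
  ... | steps≡ , refl = cong (x ∷_) (foata-injective (begin
    foata v                              ≡⟨ unfoataStep-foataStep x (foata v) ⟨
    unfoataStep x (foataStep x (foata v)) ≡⟨ cong (unfoataStep x) steps≡ ⟩
    unfoataStep x (foataStep x (foata w)) ≡⟨ unfoataStep-foataStep x (foata w) ⟩
    foata w                              ∎))
    where open ≡-Reasoning

  foataWord : List A → List A
  foataWord w = foata (reverse w)

  foataWord-↭ : ∀ w → foataWord w ↭ w
  foataWord-↭ w = subst (foataWord w ↭_) (reverse-involutive w) (foata-↭ (reverse w))

  inv-foataWord : ∀ w → inv (foataWord w) ≡ maj w
  inv-foataWord w = trans (inv-foata (reverse w)) (cong maj (reverse-involutive w))

  foataWord-injective : ∀ {v w} → foataWord v ≡ foataWord w → v ≡ w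
  foataWord-injective eq = reverse-injective (foata-injective eq)

  module Positions (κ-injective : Injective _≡_ _≡_ κ) where

    _≟ᴬ_ : DecidableEquality A
    a ≟ᴬ b with κ a ℕ.≟ κ b
    ... | yes κa≡κb = yes (κ-injective κa≡κb)
    ... | no  κa≢κb = no (κa≢κb ∘ cong κ)

    precedes : A → A → List A → Bool
    precedes b a []       = false
    precedes b a (y ∷ ys) = if does (y ≟ᴬ b) then true else if does (y ≟ᴬ a) then false else precedes b a ys

    occurrences : A → List A → ℕ
    occurrences c = count (λ y → does (y ≟ᴬ c))

    precedes-select : ∀ q {a b} w → q a ≡ true → q b ≡ true → precedes b a (select q w) ≡ precedes b a w
    precedes-select q []       qa qb = refl
    precedes-select q {a} {b} (y ∷ w) qa qb with q y in qy
    ... | true with y ≟ᴬ b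
    ...   | yes _ = refl
    ...   | no _ with y ≟ᴬ a
    ...     | yes _ = refl
    ...     | no _  = precedes-select q w qa qb
    precedes-select q {a} {b} (y ∷ w) qa qb | false with y ≟ᴬ b | y ≟ᴬ a
    ... | yes refl | _        = contradiction (trans (sym qb) qy) λ ()
    ... | no _     | yes refl = contradiction (trans (sym qa) qy) λ ()
    ... | no _     | no _     = precedes-select q w qa qb

    precedes-rotateBlocks-select : ∀ p q {a b} u →
      (∀ {a′ y} → p a′ ≡ false → p y ≡ true → q a′ ≡ false ⊎ q y ≡ false) →
      q a ≡ true → q b ≡ true → precedes b a (rotateBlocks p [] u) ≡ precedes b a u
    precedes-rotateBlocks-select p q {a} {b} u separated qa qb = begin
      precedes b a (rotateBlocks p [] u)            ≡⟨ precedes-select q (rotateBlocks p [] u) qa qb ⟨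
      precedes b a (select q (rotateBlocks p [] u)) ≡⟨ cong (precedes b a) (select-rotateBlocks p q separated [] u []) ⟩
      precedes b a (select q u)                     ≡⟨ precedes-select q u qa qb ⟩
      precedes b a u                                ∎
      where open ≡-Reasoning

    precedes-rotateBlocks : ∀ p {a b} u → p a ≡ p b → precedes b a (rotateBlocks p [] u) ≡ precedes b a u
    precedes-rotateBlocks p {a} u pa≡pb with p a in pa
    ... | true  = precedes-rotateBlocks-select p p u (λ pa′ _ → inj₁ pa′) pa (sym pa≡pb)
    ... | false =
      precedes-rotateBlocks-select p (not ∘ p) u (λ _ py → inj₂ (cong not py)) (cong not pa) (cong not (sym pa≡pb))

    ≺-adjacent : ∀ {x a b} → κ b ≡ suc (κ a) → x ≢ a → (x ≺ a) ≡ (x ≺ b)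
    ≺-adjacent {x} {a} {b} κb≡1+κa x≢a with x ≺ a in x≺a
    ... | true  = sym (<⇒<ᵇ≡true (<-trans (<ᵇ≡true⇒< x≺a) (subst (κ a <_) (sym κb≡1+κa) (n<1+n (κ a)))))
    ... | false = sym (≥⇒<ᵇ≡false (subst (_≤ κ x) (sym κb≡1+κa) κa<κx))
      where
      κa<κx = ≤∧≢⇒< (<ᵇ≡false⇒≥ x≺a) (x≢a ∘ κ-injective ∘ sym)

    precedes-foataStep : ∀ {x a b} u → κ b ≡ suc (κ a) → x ≢ a →
                         precedes b a (foataStep x u) ≡ precedes b a u
    precedes-foataStep {x} u adjacent x≢a with endsWith (x ≺_) u
    ... | true  = precedes-rotateBlocks (x ≺_) u (≺-adjacent adjacent x≢a)
    ... | false = precedes-rotateBlocks (not ∘ (x ≺_)) u (cong not (≺-adjacent adjacent x≢a))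

    precedes-∷ʳ-other : ∀ {x a b} w → x ≢ a → x ≢ b → precedes b a (w ∷ʳ x) ≡ precedes b a w
    precedes-∷ʳ-other {x} {a} {b} [] x≢a x≢b with x ≟ᴬ b | x ≟ᴬ a
    ... | yes x≡b | _        = contradiction x≡b x≢b
    ... | no _    | yes x≡a  = contradiction x≡a x≢a
    ... | no _    | no _     = refl
    precedes-∷ʳ-other {a = a} {b} (y ∷ w) x≢a x≢b with y ≟ᴬ b
    ... | yes _ = refl
    ... | no _ with y ≟ᴬ a
    ...   | yes _ = refl
    ...   | no _  = precedes-∷ʳ-other w x≢a x≢b

    precedes-∷ʳ-left : ∀ {a b} w → All (b ≢_) w → precedes b a (w ∷ʳ b) ≡ (occurrences a w ℕ.≡ᵇ 0)
    precedes-∷ʳ-left {a} {b} [] _ with b ≟ᴬ b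
    ... | yes _   = refl
    ... | no b≢b  = contradiction refl b≢b
    precedes-∷ʳ-left {a} {b} (y ∷ w) (b≢y ∷ b∉w) with y ≟ᴬ b
    ... | yes y≡b = contradiction (sym y≡b) b≢y
    ... | no _ with y ≟ᴬ a
    ...   | yes _ = refl
    ...   | no _  = precedes-∷ʳ-left w b∉w

    precedes-∷ʳ-right : ∀ {a b} w → a ≢ b → All (a ≢_) w →
                        precedes b a (w ∷ʳ a) ≡ not (occurrences b w ℕ.≡ᵇ 0)
    precedes-∷ʳ-right {a} {b} [] a≢b _ with a ≟ᴬ b
    ... | yes a≡b = contradiction a≡b a≢b
    ... | no _ with a ≟ᴬ a
    ...   | yes _  = refl
    ...   | no a≢a = contradiction refl a≢a
    precedes-∷ʳ-right {a} {b} (y ∷ w) a≢b (a≢y ∷ a∉w) with y ≟ᴬ b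
    ... | yes _ = refl
    ... | no _ with y ≟ᴬ a
    ...   | yes y≡a = contradiction (sym y≡a) a≢y
    ...   | no _    = precedes-∷ʳ-right w a≢b a∉w

    precedes-foata : ∀ {a b} w → Unique w → κ b ≡ suc (κ a) →
                     precedes b a (foata w) ≡ precedes b a (reverse w)
    precedes-foata []      _              _        = refl
    precedes-foata {a} {b} (x ∷ w) (x∉w ∷ w!) adjacent
      rewrite unfold-reverse x w with x ≟ᴬ b | x ≟ᴬ a | ↭-trans (foataStep-↭ x (foata w)) (foata-↭ w)
    ... | yes refl | _ | step↭ =
      trans (precedes-∷ʳ-left _ (All-resp-↭ (↭-sym step↭) x∉rw))
            (trans (cong (ℕ._≡ᵇ 0) (count-↭ _ step↭)) (sym (precedes-∷ʳ-left _ x∉rw)))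
      where x∉rw = All-resp-↭ (↭-sym (↭-reverse w)) x∉w
    ... | no _ | yes refl | step↭ =
      trans (precedes-∷ʳ-right _ a≢b (All-resp-↭ (↭-sym step↭) x∉rw))
            (trans (cong (λ n → not (n ℕ.≡ᵇ 0)) (count-↭ _ step↭)) (sym (precedes-∷ʳ-right _ a≢b x∉rw)))
      where
      x∉rw = All-resp-↭ (↭-sym (↭-reverse w)) x∉w
      a≢b : x ≢ b
      a≢b refl = <-irrefl adjacent (n<1+n (κ x))
    ... | no x≢b | no x≢a | _ = begin
      precedes b a (foataStep x (foata w) ∷ʳ x) ≡⟨ precedes-∷ʳ-other (foataStep x (foata w)) x≢a x≢b ⟩
      precedes b a (foataStep x (foata w))      ≡⟨ precedes-foataStep (foata w) adjacent x≢a ⟩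
      precedes b a (foata w)                    ≡⟨ precedes-foata w w! adjacent ⟩
      precedes b a (reverse w)                  ≡⟨ precedes-∷ʳ-other (reverse w) x≢a x≢b ⟨
      precedes b a (reverse w ∷ʳ x)             ∎
      where open ≡-Reasoning

    precedes-foataWord : ∀ {a b} w → Unique w → κ b ≡ suc (κ a) →
                         precedes b a (foataWord w) ≡ precedes b a w
    precedes-foataWord w w! adjacent =
      trans (precedes-foata (reverse w) (Unique-resp-↭ (↭-sym (↭-reverse w)) w!) adjacent)
            (cong (precedes _ _) (reverse-involutive w))

-- Words of G_{r,n}

adjacent⇒≢ : ∀ {i j : Fin m} → toℕ j ≡ suc (toℕ i) → j ≢ i
adjacent⇒≢ j≡1+i refl = 1+n≢n (sym j≡1+i)

fkey-< : ∀ {i j : Fin n} (c c′ : Fin r) → toℕ i < toℕ j → fkey r i c < fkey r j c′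
fkey-< {r = r} {i} {j} c c′ i<j = begin-strict
  r * toℕ i + toℕ c   <⟨ +-monoʳ-< (r * toℕ i) (toℕ<n c) ⟩
  r * toℕ i + r       ≡⟨ trans (+-comm _ r) (sym (*-suc r (toℕ i))) ⟩
  r * suc (toℕ i)     ≤⟨ *-monoʳ-≤ r i<j ⟩
  r * toℕ j           ≤⟨ m≤m+n (r * toℕ j) (toℕ c′) ⟩
  r * toℕ j + toℕ c′  ∎
  where open ≤-Reasoning

fkey-<ᵇ : ∀ {i j : Fin n} (c c′ : Fin r) → i ≢ j → (fkey r i c <ᵇ fkey r j c′) ≡ (toℕ i <ᵇ toℕ j)
fkey-<ᵇ {i = i} {j} c c′ i≢j with <-cmp (toℕ i) (toℕ j)
... | tri< i<j _ _ = trans (<⇒<ᵇ≡true (fkey-< c c′ i<j)) (sym (<⇒<ᵇ≡true i<j))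
... | tri≈ _ i≡j _ = contradiction (toℕ-injective i≡j) i≢j
... | tri> _ _ j<i = trans (≥⇒<ᵇ≡false (<⇒≤ (fkey-< c′ c j<i))) (sym (≥⇒<ᵇ≡false (<⇒≤ j<i)))

toList-tabulate-∘ : ∀ (f : A → B) (v : Vec A m) → toList (tabulate (f ∘ lookup v)) ≡ map f (toList v)
toList-tabulate-∘ f []      = refl
toList-tabulate-∘ f (x ∷ v) = cong (f x ∷_) (toList-tabulate-∘ f v)

desPos-tabulate-cong : ∀ k (f g : Fin m → ℕ) →
  (∀ {i j} → toℕ j ≡ suc (toℕ i) → (f j <ᵇ f i) ≡ (g j <ᵇ g i)) →
  desPos k (toList (tabulate f)) ≡ desPos k (toList (tabulate g))
desPos-tabulate-cong {zero}        k f g _   = refl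
desPos-tabulate-cong {suc zero}    k f g _   = refl
desPos-tabulate-cong {suc (suc m)} k f g adj
  with f (suc zero) <ᵇ f zero | g (suc zero) <ᵇ g zero | adj {zero} {suc zero} refl
     | desPos-tabulate-cong (suc k) (f ∘ suc) (g ∘ suc) (λ e → adj (cong suc e))
... | true  | true  | _ | rest = cong (k ∷_) rest
... | false | false | _ | rest = rest

count-tabulate-cong : ∀ (p q : ℕ → Bool) (f g : Fin m → ℕ) → (∀ i → p (f i) ≡ q (g i)) →
                      count p (toList (tabulate f)) ≡ count q (toList (tabulate g))
count-tabulate-cong {zero}  p q f g _  = refl
count-tabulate-cong {suc m} p q f g pf≡qg with p (f zero) | q (g zero) | pf≡qg zero
... | true  | true  | _ = cong suc (count-tabulate-cong p q (f ∘ suc) (g ∘ suc) (pf≡qg ∘ suc))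
... | false | false | _ = count-tabulate-cong p q (f ∘ suc) (g ∘ suc) (pf≡qg ∘ suc)

invList-tabulate-cong : ∀ (f g : Fin m → ℕ) → (∀ {i j} → i ≢ j → (f j <ᵇ f i) ≡ (g j <ᵇ g i)) →
                        invList (toList (tabulate f)) ≡ invList (toList (tabulate g))
invList-tabulate-cong {zero}  f g _    = refl
invList-tabulate-cong {suc m} f g diff =
  cong₂ _+_ (count-tabulate-cong (_<ᵇ f zero) (_<ᵇ g zero) (f ∘ suc) (g ∘ suc) (λ i → diff λ ()))
            (invList-tabulate-cong (f ∘ suc) (g ∘ suc) (λ i≢j → diff (i≢j ∘ suc-injective)))

module _ {n : ℕ} where
  open Foata {Fin n} toℕ
  open Positions toℕ-injective

  precedes-lookup : ∀ {m} (v : Vec (Fin n) m) → Injective _≡_ _≡_ (lookup v) → ∀ {p q} → p ≢ q →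
                    precedes (lookup v p) (lookup v q) (toList v) ≡ (toℕ p <ᵇ toℕ q)
  precedes-lookup (x ∷ v) inj {zero}  {zero}  p≢q = contradiction refl p≢q
  precedes-lookup (x ∷ v) inj {zero}  {suc q} p≢q with x ≟ᴬ x
  ... | yes _   = refl
  ... | no x≢x  = contradiction refl x≢x
  precedes-lookup (x ∷ v) inj {suc p} {zero}  p≢q with x ≟ᴬ lookup v p
  ... | yes x≡vp = contradiction (inj {zero} {suc p} x≡vp) λ ()
  ... | no _ with x ≟ᴬ x
  ...   | yes _  = refl
  ...   | no x≢x = contradiction refl x≢x
  precedes-lookup (x ∷ v) inj {suc p} {suc q} p≢q with x ≟ᴬ lookup v p
  ... | yes x≡vp = contradiction (inj {zero} {suc p} x≡vp) λ ()
  ... | no _ with x ≟ᴬ lookup v q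
  ...   | yes x≡vq = contradiction (inj {zero} {suc q} x≡vq) λ ()
  ...   | no _     = precedes-lookup v (suc-injective ∘ inj) (p≢q ∘ cong suc)

  foataPerm : Vec (Fin n) n → Vec (Fin n) n
  foataPerm π =
    cast (trans (↭-length (foataWord-↭ (toList π))) (length-toList π)) (fromList (foataWord (toList π)))

  toList-foataPerm : ∀ π → toList (foataPerm π) ≡ foataWord (toList π)
  toList-foataPerm π = trans (toList-cast _ (fromList (foataWord (toList π)))) (toList∘fromList _)

  foataPerm-injective : Injective _≡_ _≡_ foataPerm
  foataPerm-injective {π} {π′} eq =
    trans (sym (cast-is-id refl π)) (toList-injective refl π π′ (foataWord-injective (begin
      foataWord (toList π)  ≡⟨ toList-foataPerm π ⟨
      toList (foataPerm π)  ≡⟨ cong toList eq ⟩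
      toList (foataPerm π′) ≡⟨ toList-foataPerm π′ ⟩
      foataWord (toList π′) ∎)))
    where open ≡-Reasoning

  lookup-foataPerm-injective : ∀ π → isPerm π ≡ true → Injective _≡_ _≡_ (lookup (foataPerm π))
  lookup-foataPerm-injective π perm = unique⇒injective (foataPerm π)
    (subst Unique (sym (toList-foataPerm π))
      (Unique-resp-↭ (↭-sym (foataWord-↭ (toList π))) (injective⇒unique π (isPerm⇒injective π perm))))

  foataPerm-isPerm : ∀ π → isPerm π ≡ true → isPerm (foataPerm π) ≡ true
  foataPerm-isPerm π perm = injective⇒isPerm (foataPerm π) (lookup-foataPerm-injective π perm)

  module _ {r : ℕ} (z : Vec (Fin r) n) where

    key : Vec (Fin n) n → Fin n → ℕ
    key π k = fkey r (lookup π k) (lookup z k)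

    key-<ᵇ : ∀ π {i j} → lookup π i ≢ lookup π j →
             (key π i <ᵇ key π j) ≡ (toℕ (lookup π i) <ᵇ toℕ (lookup π j))
    key-<ᵇ π = fkey-<ᵇ (lookup z _) (lookup z _)

    majF≡maj : ∀ π → Injective _≡_ _≡_ (lookup π) → majF (z , π) ≡ maj (toList π)
    majF≡maj π inj = cong sum (trans
      (desPos-tabulate-cong 1 (key π) (toℕ ∘ lookup π) (λ j≡1+i → key-<ᵇ π (adjacent⇒≢ j≡1+i ∘ inj)))
      (cong (desPos 1) (toList-tabulate-∘ toℕ π)))

    invF≡inv : ∀ π → Injective _≡_ _≡_ (lookup π) → invF (z , π) ≡ inv (toList π)
    invF≡inv π inj = trans
      (invList-tabulate-cong (key π) (toℕ ∘ lookup π) (λ i≢j → key-<ᵇ π (i≢j ∘ sym ∘ inj)))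
      (cong invList (toList-tabulate-∘ toℕ π))

    key-invPerm-<ᵇ : ∀ σ → Injective _≡_ _≡_ (lookup σ) → ∀ {i j} → i ≢ j →
                     (key (invPerm σ) i <ᵇ key (invPerm σ) j) ≡ precedes i j (toList σ)
    key-invPerm-<ᵇ σ inj {i} {j} i≢j = begin
      (key (invPerm σ) i <ᵇ key (invPerm σ) j)
        ≡⟨ key-<ᵇ (invPerm σ) p≢q ⟩
      (toℕ p <ᵇ toℕ q)
        ≡⟨ precedes-lookup σ inj p≢q ⟨
      precedes (lookup σ p) (lookup σ q) (toList σ)
        ≡⟨ cong₂ (λ b a → precedes b a (toList σ)) (lookup-invPerm σ inj i) (lookup-invPerm σ inj j) ⟩
      precedes i j (toList σ)
        ∎
      where
      open ≡-Reasoning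
      p = lookup (invPerm σ) i
      q = lookup (invPerm σ) j
      p≢q : p ≢ q
      p≢q p≡q = i≢j (trans (sym (lookup-invPerm σ inj i)) (trans (cong (lookup σ) p≡q) (lookup-invPerm σ inj j)))

    desF-invPerm-foataPerm : ∀ π → isPerm π ≡ true → desF (z , invPerm (foataPerm π)) ≡ desF (z , invPerm π)
    desF-invPerm-foataPerm π perm =
      cong length (desPos-tabulate-cong 1 (key (invPerm (foataPerm π))) (key (invPerm π)) λ {i} {j} j≡1+i → begin
        (key (invPerm (foataPerm π)) j <ᵇ key (invPerm (foataPerm π)) i)
          ≡⟨ key-invPerm-<ᵇ (foataPerm π) (lookup-foataPerm-injective π perm) (adjacent⇒≢ j≡1+i) ⟩
        precedes j i (toList (foataPerm π))
          ≡⟨ cong (precedes j i) (toList-foataPerm π) ⟩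
        precedes j i (foataWord (toList π))
          ≡⟨ precedes-foataWord (toList π) (injective⇒unique π π-injective) j≡1+i ⟩
        precedes j i (toList π)
          ≡⟨ key-invPerm-<ᵇ π π-injective (adjacent⇒≢ j≡1+i) ⟨
        (key (invPerm π) j <ᵇ key (invPerm π) i) ∎)
      where
      open ≡-Reasoning
      π-injective = isPerm⇒injective π perm

    invF-foataPerm : ∀ π → isPerm π ≡ true → invF (z , foataPerm π) ≡ majF (z , π)
    invF-foataPerm π perm = begin
      invF (z , foataPerm π)      ≡⟨ invF≡inv (foataPerm π) (lookup-foataPerm-injective π perm) ⟩
      inv (toList (foataPerm π))  ≡⟨ cong inv (toList-foataPerm π) ⟩
      inv (foataWord (toList π))  ≡⟨ inv-foataWord (toList π) ⟩
      maj (toList π)              ≡⟨ majF≡maj π (isPerm⇒injective π perm) ⟨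
      majF (z , π)                ∎
      where open ≡-Reasoning

foataG : G r n → G r n
foataG (z , π) = z , foataPerm π

foataG-injective : Injective _≡_ _≡_ (foataG {r} {n})
foataG-injective {x = z , π} {z′ , π′} eq with refl ← cong proj₁ eq =
  cong (z ,_) (foataPerm-injective (cong proj₂ eq))

foataG-∈-allG : ∀ {g} → g ∈ allG r n → foataG g ∈ allG r n
foataG-∈-allG {g = z , π} = ∈-allG-map foataPerm foataPerm-isPerm

finvF-foataG : ∀ {g} → g ∈ allG r n → finvF (foataG g) ≡ flagMajorF g
finvF-foataG {r = r} {g = z , π} g∈ =
  cong (λ k → r * k + csum (z , π)) (invF-foataPerm z π (∈-allG⇒isPerm g∈))

ldesF-bar-foataG : ∀ {g} → g ∈ allG r n → ldesF (bar (foataG g)) ≡ ldesF (bar g)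
ldesF-bar-foataG {g = z , π} g∈ = cong (_+ csum (z , π)) (desF-invPerm-foataPerm z π (∈-allG⇒isPerm g∈))

mainTheorem11 : (r n : ℕ) → 1 ≤ r → 1 ≤ n → (a b : ℕ) →
    coeff r n flagMajorF (λ g → ldesF (bar g)) a b
      ≡ coeff r n finvF (λ g → ldesF (bar g)) a b
mainTheorem11 r n _ _ a b = sym (begin
  coeff r n finvF (ldesF ∘ bar) a b
    ≡⟨ count-reindex (atMonomial finvF) foataG-injective (allG-unique r n) foataG-∈-allG ⟩
  count (atMonomial finvF ∘ foataG) (allG r n)
    ≡⟨ count-cong-∈ (allG r n) (λ g∈ →
         cong₂ (λ i d → (i ≡ᵇ a) ∧ (d ≡ᵇ b)) (finvF-foataG g∈) (ldesF-bar-foataG g∈)) ⟩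
  coeff r n flagMajorF (ldesF ∘ bar) a b
    ∎)
  where
  open ≡-Reasoning
  atMonomial : (G r n → ℕ) → G r n → Bool
  atMonomial f g = (f g ≡ᵇ a) ∧ (ldesF (bar g) ≡ᵇ b)
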